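{- Let $k$ be a positive integer, $A\subseteq[k]$, and let $c_\alpha\in\mathbb{Z}$ for each $\alpha\in A$. Suppose that for all $\alpha,\alpha'\in A$: (1) $\operatorname{lcm}(\alpha,\alpha')\in A$, and (2) $(c_{\alpha'}-c_\alpha)\cdot\operatorname{lcm}(\alpha,\alpha')\equiv 0\pmod k$. Then there exists $c\in\mathbb{Z}$ such that $(c-c_\alpha)\alpha\equiv 0\pmod k$ for all $\alpha\in A$.
   Context: $[k]=\{1,\ldots,k\}$. -}

module Defs where

open import Data.Nat using (ℕ)
open import Data.Integer using (ℤ; _*_; _-_; +_)
open import Data.Integer.Divisibility using (_∣_)

_≡0mod_ : ℤ → ℕ → Set
x ≡0mod k = (+ k) ∣ x

{-# OPTIONS --safe #-}

-- With m_α = k / gcd(k, α), the condition k ∣ (z − c_α)·α says z ≡ c_α (mod m_α), and the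
-- hypothesis says that c_α ≡ c_α′ modulo gcd(m_α, m_α′): this is the Chinese remainder theorem
-- for non-coprime moduli, which we prove without ever dividing by k.  The congruences are solved
-- one at a time.  Given z solving those for α₁, …, αₙ, put g = gcd(α₁, …, αₙ) and look for a
-- correction y with k ∣ y·g, so that z + y still solves them, and k ∣ (c_β − z − y)·β, so that
-- z + y also solves the one for β.  Bézout for g and β produces such a y as soon as
-- k ∣ (c_β − z)·lcm(g, β).  This follows from k ∣ (c_β − z)·lcm(αᵢ, β) for every i, which is
-- the compatibility of αᵢ and β, because gcd(lcm(a, c), lcm(b, c)) divides lcm(gcd(a, b), c).

module Submission where

open import Defs
open import Data.Bool using (Bool; T)
open import Data.Nat using (ℕ; _≤_)
open import Data.Nat.LCM using (lcm)
open import Data.Integer using (ℤ; _*_; _-_; +_)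
open import Data.Product using (Σ; _×_)

import Data.Nat as ℕ
import Data.Nat.Divisibility as ℕ
import Data.Nat.Properties as ℕ
open import Data.Nat using (zero; suc; s≤s; NonZero; ≢-nonZero)
open import Data.Nat.Coprimality using (coprime-/gcd; coprime-factors)
open import Data.Nat.DivMod using (m/n*n≡m; m*[n/m]≡n)
open import Data.Nat.GCD
  using (gcd; gcd-GCD; gcd[m,n]∣m; gcd[m,n]∣n; gcd-greatest; gcd[m,n]≢0; gcd-identityˡ
        ; c*gcd[m,n]≡gcd[cm,cn]; module Bézout)
open import Data.Nat.LCM using (m∣lcm[m,n]; n∣lcm[m,n]; lcm-least)
open import Data.Integer using (_+_; -_)
import Data.Integer as ℤ using (∣_∣)
open import Data.Integer.Properties using (+-comm; *-comm; *-assoc; *-zeroʳ; pos-+; pos-*; abs-*)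
open import Data.Integer.Divisibility.Signed
  using (_∣_; divides; ∣ᵤ⇒∣; ∣⇒∣ᵤ; ∣m⇒∣m*n; ∣m⇒∣-m; ∣m∣n⇒∣m+n; ∣m∣n⇒∣m-n)
open import Data.Integer.Tactic.RingSolver using (solve-∀)
open import Data.List using (List; []; _∷_; foldr; filter; upTo)
open import Data.List.Membership.Propositional using (_∈_)
open import Data.List.Membership.Propositional.Properties using (∈-filter⁺; ∈-filter⁻; ∈-upTo⁺)
open import Data.List.Relation.Unary.All as All using (All; []; _∷_)
open import Data.List.Relation.Unary.Any using (here; there)
open import Data.Product using (_,_; proj₂; ∃-syntax; ∃₂)
open import Data.Sum using (inj₁)
open import Function using (_∘_)
open import Relation.Binary.PropositionalEquality using (_≡_; refl; sym; trans; cong; subst; module ≡-Reasoning)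
open import Relation.Nullary using (yes; no)
open import Relation.Nullary.Decidable using (T?)

lcm∣[m/g]*lcm[g,n] : ∀ {m g} n .{{_ : NonZero g}} → g ℕ.∣ m → lcm m n ℕ.∣ (m ℕ./ g) ℕ.* lcm g n
lcm∣[m/g]*lcm[g,n] {m} {g} n g∣m = lcm-least m∣[m/g]*lcm[g,n] (ℕ.∣n⇒∣m*n (m ℕ./ g) (n∣lcm[m,n] g n))
  where
  m∣[m/g]*lcm[g,n] : m ℕ.∣ (m ℕ./ g) ℕ.* lcm g n
  m∣[m/g]*lcm[g,n] = subst (ℕ._∣ (m ℕ./ g) ℕ.* lcm g n) (m/n*n≡m g∣m)
    (ℕ.*-monoʳ-∣ (m ℕ./ g) (m∣lcm[m,n] g n))

gcd[lcm[a,c],lcm[b,c]]∣lcm[gcd[a,b],c] : ∀ a b c → gcd (lcm a c) (lcm b c) ℕ.∣ lcm (gcd a b) c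
gcd[lcm[a,c],lcm[b,c]]∣lcm[gcd[a,b],c] a b c with gcd a b ℕ.≟ 0
... | yes g≡0 rewrite g≡0 = gcd (lcm a c) (lcm b c) ℕ.∣0
... | no g≢0 = coprime-factors (coprime-/gcd a b)
  ( ℕ.∣-trans (gcd[m,n]∣m (lcm a c) (lcm b c)) (lcm∣[m/g]*lcm[g,n] c (gcd[m,n]∣m a b))
  , ℕ.∣-trans (gcd[m,n]∣n (lcm a c) (lcm b c)) (lcm∣[m/g]*lcm[g,n] c (gcd[m,n]∣n a b)) )
  where instance _ = ≢-nonZero g≢0

∣*lcm[gcd] : ∀ {k} d a b c → + k ∣ d * + lcm a c → + k ∣ d * + lcm b c → + k ∣ d * + lcm (gcd a b) c
∣*lcm[gcd] {k} d a b c k∣d*lcm[a,c] k∣d*lcm[b,c] = fromℕ (begin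
  k                                                  ∣⟨ gcd-greatest (toℕ k∣d*lcm[a,c]) (toℕ k∣d*lcm[b,c]) ⟩
  gcd (ℤ.∣ d ∣ ℕ.* lcm a c) (ℤ.∣ d ∣ ℕ.* lcm b c)    ≡⟨ c*gcd[m,n]≡gcd[cm,cn] ℤ.∣ d ∣ (lcm a c) (lcm b c) ⟨
  ℤ.∣ d ∣ ℕ.* gcd (lcm a c) (lcm b c)                ∣⟨ ℕ.*-monoʳ-∣ ℤ.∣ d ∣ (gcd[lcm[a,c],lcm[b,c]]∣lcm[gcd[a,b],c] a b c) ⟩
  ℤ.∣ d ∣ ℕ.* lcm (gcd a b) c                        ∎)
  where
  toℕ : ∀ {n} → + k ∣ d * + n → k ℕ.∣ ℤ.∣ d ∣ ℕ.* n
  toℕ {n} h = subst (k ℕ.∣_) (abs-* d (+ n)) (∣⇒∣ᵤ h)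
  fromℕ : ∀ {n} → k ℕ.∣ ℤ.∣ d ∣ ℕ.* n → + k ∣ d * + n
  fromℕ {n} h = ∣ᵤ⇒∣ (subst (k ℕ.∣_) (sym (abs-* d (+ n))) h)
  open ℕ.∣-Reasoning

∣x*m⇒∣x*n : ∀ {i} x {m n} → m ℕ.∣ n → i ∣ x * + m → i ∣ x * + n
∣x*m⇒∣x*n {i} x {m} (ℕ.divides q refl) i∣x*m = subst (i ∣_) x*m*q≡x*[q*m] (∣m⇒∣m*n (+ q) i∣x*m)
  where
  x*m*q≡x*[q*m] : x * + m * + q ≡ x * + (q ℕ.* m)
  x*m*q≡x*[q*m] = trans (*-assoc x (+ m) (+ q)) (cong (x *_) (trans (*-comm (+ m) (+ q)) (sym (pos-* q m))))

bézout : ∀ a b → ∃₂ λ s t → + gcd a b ≡ s * + a + t * + b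
bézout a b = fromIdentity (Bézout.identity (gcd-GCD a b))
  where
  isolate : ∀ {g} u v p q → g ℕ.+ u ℕ.* v ≡ p ℕ.* q → + g ≡ + p * + q + - + u * + v
  isolate {g} u v p q eq = begin
    + g                               ≡⟨ cancel (+ g) (+ u) (+ v) ⟩
    + g + + u * + v + - + u * + v     ≡⟨ cong (λ n → + g + n + - + u * + v) (pos-* u v) ⟨
    + g + + (u ℕ.* v) + - + u * + v   ≡⟨ cong (_+ - + u * + v) (pos-+ g (u ℕ.* v)) ⟨
    + (g ℕ.+ u ℕ.* v) + - + u * + v   ≡⟨ cong (λ n → + n + - + u * + v) eq ⟩
    + (p ℕ.* q) + - + u * + v         ≡⟨ cong (_+ - + u * + v) (pos-* p q) ⟩
    + p * + q + - + u * + v           ∎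
    where
    open ≡-Reasoning
    cancel : ∀ g u v → g ≡ g + u * v + - u * v
    cancel = solve-∀
  fromIdentity : Bézout.Identity (gcd a b) a b → ∃₂ λ s t → + gcd a b ≡ s * + a + t * + b
  fromIdentity (Bézout.+- x y eq) = + x , - + y , isolate y b x a eq
  fromIdentity (Bézout.-+ x y eq) = - + x , + y , trans (isolate x a y b eq) (+-comm (+ y * + b) (- + x * + a))

lcm-cofactor : ∀ a b → ∃[ b′ ] b ≡ gcd a b ℕ.* b′ × lcm a b ≡ a ℕ.* b′
lcm-cofactor zero b = 1 , sym (trans (ℕ.*-identityʳ (gcd 0 b)) (gcd-identityˡ b)) , refl
lcm-cofactor a@(suc _) b = b ℕ./ gcd a b , sym (m*[n/m]≡n (gcd[m,n]∣n a b)) , refl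
  where instance _ = ≢-nonZero (gcd[m,n]≢0 a b (inj₁ λ ()))

chinese-remainder₂ : ∀ {k} d a b → + k ∣ d * + lcm a b → ∃[ y ] (+ k ∣ y * + a × + k ∣ (d - y) * + b)
chinese-remainder₂ {k} d a b k∣d*lcm with bézout a b | lcm-cofactor a b
... | s , t , g≡sa+tb | b′ , b≡g*b′ , lcm≡a*b′ =
  -- y = d t b′ gives y a = d t lcm a b and, from b = g b′ = (s a + t b) b′, (d − y) b = d s lcm a b.
  d * t * B′ ,
  subst (+ k ∣_) y*a≡d*lcm*t (∣m⇒∣m*n t k∣d*lcm) ,
  subst (+ k ∣_) [d-y]*b≡d*lcm*s (∣m⇒∣m*n s k∣d*lcm)
  where
  open ≡-Reasoning
  A = + a
  B = + b
  B′ = + b′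
  lcm≡A*B′ : + lcm a b ≡ A * B′
  lcm≡A*B′ = trans (cong +_ lcm≡a*b′) (pos-* a b′)
  y*a≡d*lcm*t : d * + lcm a b * t ≡ d * t * B′ * A
  y*a≡d*lcm*t = trans (cong (λ L → d * L * t) lcm≡A*B′) (shuffle d A B′ t)
    where
    shuffle : ∀ d a b′ t → d * (a * b′) * t ≡ d * t * b′ * a
    shuffle = solve-∀
  [d-y]*b≡d*lcm*s : d * + lcm a b * s ≡ (d - d * t * B′) * B
  [d-y]*b≡d*lcm*s = begin
    d * + lcm a b * s                       ≡⟨ cong (λ L → d * L * s) lcm≡A*B′ ⟩
    d * (A * B′) * s                        ≡⟨ expand d A B′ s t B ⟩
    d * ((s * A + t * B) * B′ - t * B * B′) ≡⟨ cong (λ g → d * (g * B′ - t * B * B′)) g≡sa+tb ⟨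
    d * (+ gcd a b * B′ - t * B * B′)       ≡⟨ cong (λ n → d * (n - t * B * B′)) (pos-* (gcd a b) b′) ⟨
    d * (+ (gcd a b ℕ.* b′) - t * B * B′)   ≡⟨ cong (λ n → d * (+ n - t * B * B′)) b≡g*b′ ⟨
    d * (B - t * B * B′)                    ≡⟨ collect d B B′ t ⟩
    (d - d * t * B′) * B                    ∎
    where
    expand : ∀ d a b′ s t b → d * (a * b′) * s ≡ d * ((s * a + t * b) * b′ - t * b * b′)
    expand = solve-∀
    collect : ∀ d b b′ t → d * (b - t * b * b′) ≡ (d - d * t * b′) * b
    collect = solve-∀

gcdᴸ : List ℕ → ℕ
gcdᴸ = foldr gcd 0

gcdᴸ∣ : ∀ αs → All (gcdᴸ αs ℕ.∣_) αs
gcdᴸ∣ [] = []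
gcdᴸ∣ (α ∷ αs) = gcd[m,n]∣m α (gcdᴸ αs) ∷ All.map (ℕ.∣-trans (gcd[m,n]∣n α (gcdᴸ αs))) (gcdᴸ∣ αs)

∣*lcm[gcdᴸ] : ∀ {k} d β {αs} → All (λ α → + k ∣ d * + lcm α β) αs → + k ∣ d * + lcm (gcdᴸ αs) β
∣*lcm[gcdᴸ] d β [] = divides (+ 0) (*-zeroʳ d)
∣*lcm[gcdᴸ] d β {α ∷ αs} (k∣d*lcm[α,β] ∷ k∣d*lcm[αs,β]) =
  ∣*lcm[gcd] d α (gcdᴸ αs) β k∣d*lcm[α,β] (∣*lcm[gcdᴸ] d β k∣d*lcm[αs,β])

module _ (k : ℕ) (c : ℕ → ℤ) where

  Solves : ℤ → ℕ → Set
  Solves z α = + k ∣ (z - c α) * + α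

  Compatible : ℕ → ℕ → Set
  Compatible α β = + k ∣ (c β - c α) * + lcm α β

  solves⇒∣*lcm : ∀ {z α β} → Solves z α → Compatible α β → + k ∣ (c β - z) * + lcm α β
  solves⇒∣*lcm {z} {α} {β} z-solves-α α~β = subst (+ k ∣_) (difference (c β) (c α) z (+ lcm α β))
    (∣m∣n⇒∣m-n α~β (∣x*m⇒∣x*n (z - c α) (m∣lcm[m,n] α β) z-solves-α))
    where
    difference : ∀ cβ cα z l → (cβ - cα) * l - (z - cα) * l ≡ (cβ - z) * l
    difference = solve-∀

  solves-+ : ∀ z y {α} → Solves z α → + k ∣ y * + α → Solves (z + y) α
  solves-+ z y {α} z-solves-α k∣y*α = subst (+ k ∣_) (add z (c α) y (+ α)) (∣m∣n⇒∣m+n z-solves-α k∣y*α)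
    where
    add : ∀ z cα y a → (z - cα) * a + y * a ≡ (z + y - cα) * a
    add = solve-∀

  ∣[cβ-z-y]*β⇒solves : ∀ z y {β} → + k ∣ (c β - z - y) * + β → Solves (z + y) β
  ∣[cβ-z-y]*β⇒solves z y {β} k∣[cβ-z-y]*β = subst (+ k ∣_) (negate (c β) z y (+ β)) (∣m⇒∣-m k∣[cβ-z-y]*β)
    where
    negate : ∀ cβ z y b → - ((cβ - z - y) * b) ≡ (z + y - cβ) * b
    negate = solve-∀

  extend : ∀ z β {αs} → All (Solves z) αs → All (λ α → Compatible α β) αs →
           ∃[ z′ ] (Solves z′ β × All (Solves z′) αs)
  extend z β {αs} z-solves-αs αs~β =
    let y , k∣y*gcd , k∣[cβ-z-y]*β = chinese-remainder₂ (c β - z) (gcdᴸ αs) β k∣[cβ-z]*lcm[gcd,β]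
        k∣y*αs = All.map (λ g∣α → ∣x*m⇒∣x*n y g∣α k∣y*gcd) (gcdᴸ∣ αs)
    in z + y , ∣[cβ-z-y]*β⇒solves z y k∣[cβ-z-y]*β , All.zipWith (λ (s , t) → solves-+ z y s t) (z-solves-αs , k∣y*αs)
    where
    k∣[cβ-z]*lcm[gcd,β] : + k ∣ (c β - z) * + lcm (gcdᴸ αs) β
    k∣[cβ-z]*lcm[gcd,β] = ∣*lcm[gcdᴸ] (c β - z) β (All.zipWith (λ (s , t) → solves⇒∣*lcm s t) (z-solves-αs , αs~β))

  chinese-remainder : ∀ αs → (∀ {α β} → α ∈ αs → β ∈ αs → Compatible α β) → ∃[ z ] All (Solves z) αs
  chinese-remainder [] _ = + 0 , []
  chinese-remainder (β ∷ αs) compatible =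
    let z , z-solves-αs = chinese-remainder αs (λ α∈αs β∈αs → compatible (there α∈αs) (there β∈αs))
        z′ , z′-solves-β , z′-solves-αs = extend z β z-solves-αs (All.tabulate (λ α∈αs → compatible (there α∈αs) (here refl)))
    in z′ , z′-solves-β ∷ z′-solves-αs

lemma3p10 : (k : ℕ) → 1 ≤ k →
    (A : ℕ → Bool) → (∀ α → T (A α) → 1 ≤ α × α ≤ k) →
    (c : ℕ → ℤ) →
    (∀ α α' → T (A α) → T (A α') → T (A (lcm α α'))) →
    (∀ α α' → T (A α) → T (A α') → ((c α' - c α) * + lcm α α') ≡0mod k) →
    Σ ℤ (λ z → ∀ α → T (A α) → ((z - c α) * + α) ≡0mod k)
lemma3p10 k _ A A⊆[1,k] c _ compatible =
  let z , z-solves = chinese-remainder k c αs (λ α∈αs β∈αs → ∣ᵤ⇒∣ (compatible _ _ (∈A α∈αs) (∈A β∈αs)))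
  in z , λ α α∈A → ∣⇒∣ᵤ (All.lookup z-solves (∈αs α∈A))
  where
  αs : List ℕ
  αs = filter (T? ∘ A) (upTo (suc k))
  ∈A : ∀ {α} → α ∈ αs → T (A α)
  ∈A = proj₂ ∘ ∈-filter⁻ (T? ∘ A)
  ∈αs : ∀ {α} → T (A α) → α ∈ αs
  ∈αs {α} α∈A = ∈-filter⁺ (T? ∘ A) (∈-upTo⁺ (s≤s (proj₂ (A⊆[1,k] α α∈A)))) α∈A
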